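{- We have \begin{align*} \mathcal{Z}_{q} & =\mathrm{span}_{\mathbb{Q}}\{\zeta_{q}^{\dagger}(\boldsymbol{k})\mid\boldsymbol{k}\in\bar{\mathbb{I}}^{\mathrm{adm}}\},\qquad \mathcal{Z}_{q}^{\circ} =\mathrm{span}_{\mathbb{Q}}\{\zeta_{q}^{\dagger}(\boldsymbol{k})\mid\boldsymbol{k}\in\bar{\mathbb{I}}^{\mathrm{adm}},\ k_{i}\neq\bar{1}\text{ for all }i\},\\ \mathcal{Z}_{q,1} & =\mathrm{span}_{\mathbb{Q}}\{\zeta_{q}^{\mathrm{BZ}}(\boldsymbol{k})\mid\boldsymbol{k}\in\mathbb{I}^{\mathrm{adm}}\},\qquad \mathcal{Z}_{q,1}^{\circ} =\mathrm{span}_{\mathbb{Q}}\{\zeta_{q}^{\mathrm{BZ}}(\boldsymbol{k})\mid\boldsymbol{k}\in\mathbb{I}^{\mathrm{adm}},\ k_{i}\neq1\text{ for all }i\}. \end{align*}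
   Context: For $r\ge1$, integers $k_j\ge1$, $Q_1,\dots,Q_{r-1}\in\mathbb Q[X]$, $Q_r\in X\mathbb Q[X]$ with $\deg Q_j\le k_j$, set $\zeta_q(k_1,\dots,k_r;Q_1,\dots,Q_r)=\sum_{0<n_1<\cdots<n_r}\prod_{j}\frac{Q_j(q^{n_j})}{(1-q^{n_j})^{k_j}}$, and $\zeta_q(\emptyset;\emptyset)=1$. For $d\in\{0,1\}$, $\mathcal Z_{q,d}$ is the $\mathbb Q$-span of these with $r\ge0$, $\deg Q_j\le k_j-d$, $Q_r\in X\mathbb Q[X]$, and $\mathcal Z_{q,d}^\circ$ the span of those with moreover all $Q_j\in X\mathbb Q[X]$; $\mathcal Z_q=\mathcal Z_{q,0}$, $\mathcal Z_q^\circ=\mathcal Z_{q,0}^\circ$. Index sets: $\mathbb I$ = all tuples $(k_1,\dots,k_r)\in\mathbb Z_{\ge1}^r$, $r\ge0$; $\mathbb I^{\mathrm{adm}}$ = those with $r=0$ or $k_r\ne1$; with $\bar1$ a formal symbol, $\bar{\mathbb I}$ = tuples with entries in $\{\bar1\}\cup\mathbb Z_{\ge1}$, $\bar{\mathbb I}^{\mathrm{adm}}$ = those with $r=0$ or $k_r\ne\bar1$. For $\boldsymbol k\in\bar{\mathbb I}^{\mathrm{adm}}$: $\zeta_q^\dagger(\boldsymbol k)=\sum_{0<n_1\le\cdots\le n_r,\ n_i<n_{i+1}\text{ whenever }k_i\ne\bar1}\prod_{j:\,k_j\ne\bar1}\frac{q^{n_j}}{(1-q^{n_j})^{k_j}}$.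 For $\boldsymbol k\in\mathbb I^{\mathrm{adm}}$: $\zeta_q^{\mathrm{BZ}}(\boldsymbol k)=\sum_{0<n_1<\cdots<n_r}\prod_j\frac{q^{n_j(k_j-1)}}{(1-q^{n_j})^{k_j}}$. Empty tuples give $1$. -}

module Defs where

open import Data.Nat using (ℕ; zero; suc; _∸_; _≤_)
open import Data.Nat.DivMod using (_%_; _/_)
open import Data.Bool using (Bool; true; false; if_then_else_)
open import Data.List using (List; []; _∷_; length; map; applyUpTo)
open import Data.List.Relation.Unary.All using (All)
open import Data.Product using (_×_; _,_; proj₁; proj₂; Σ; ∃)
open import Data.Unit using (⊤)
open import Data.Empty using (⊥)
open import Data.Rational using (ℚ; 0ℚ; 1ℚ; _+_; _*_)
open import Relation.Binary.PropositionalEquality using (_≡_)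
open import Relation.Nullary using (¬_)

-- Formal power series in q over ℚ, as coefficient sequences.

PS : Set
PS = ℕ → ℚ

sumℚ : List ℚ → ℚ
sumℚ [] = 0ℚ
sumℚ (x ∷ xs) = x + sumℚ xs

sumTo : ℕ → (ℕ → ℚ) → ℚ
sumTo N h = sumℚ (applyUpTo h (suc N))

-- Σ_{lo ≤ p ≤ N} h p   (empty if lo > N)
sumRange : ℕ → ℕ → (ℕ → ℚ) → ℚ
sumRange lo N h = sumℚ (applyUpTo (λ i → h (lo Data.Nat.+ i)) (suc N ∸ lo))

oneS : PS
oneS zero = 1ℚ
oneS (suc _) = 0ℚ

_*S_ : PS → PS → PS
(f *S g) N = sumTo N (λ i → f i * g (N ∸ i))

-- 1/(1-x) = Σ x^m
geomS : PS
geomS _ = 1ℚ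

-- 1/(1-x)^k
geomPow : ℕ → PS
geomPow zero = oneS
geomPow (suc k) = geomS *S geomPow k

-- Polynomials over ℚ: coefficient lists, constant term first.
Poly : Set
Poly = List ℚ

polyS : Poly → PS
polyS [] _ = 0ℚ
polyS (c ∷ cs) zero = c
polyS (c ∷ cs) (suc m) = polyS cs m

-- Q ∈ X ℚ[X]  (zero constant term)
InXQ : Poly → Set
InXQ Q = polyS Q 0 ≡ 0ℚ

-- deg Q ≤ e, rendered as: Q has at most e+1 coefficients
DegLe : Poly → ℕ → Set
DegLe Q e = length Q ≤ suc e

-- f(x) ↦ f(q^(p+1))
dil : ℕ → PS → PS
dil p f m with m % suc p
... | zero = f (m / suc p)
... | suc _ = 0ℚ

-- Each entry is (f, strict): the summation variable n = p+1
-- contributes the factor f(q^n); if strict, the next variable is > n,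
-- otherwise ≥ n.  The first variable is ≥ 1 (p ≥ lo = 0).
-- Coefficient of q^N: terms with n > N vanish for all series used below
-- (each summand has q-order ≥ n, as the last factor is divisible by
-- q^{n_r} and n_r ≥ n), so the sum over n is truncated at n ≤ N+1.
nest : List (PS × Bool) → ℕ → PS
nest [] lo = oneS
nest ((f , s) ∷ es) lo N =
  sumRange lo N (λ p → (dil p f *S nest es (if s then suc p else p)) N)

-- ζ_q(k_1..k_r; Q_1..Q_r) with data list of pairs (k_j , Q_j)

factor : ℕ × Poly → PS
factor (k , Q) = polyS Q *S geomPow k

zetaQ : List (ℕ × Poly) → PS
zetaQ ks = nest (map (λ kQ → (factor kQ , true)) ks) 0

LastInXQ : List (ℕ × Poly) → Set
LastInXQ [] = ⊤
LastInXQ ((_ , Q) ∷ []) = InXQ Q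
LastInXQ (_ ∷ y ∷ ys) = LastInXQ (y ∷ ys)

ValidD : ℕ → List (ℕ × Poly) → Set
ValidD d ks = All (λ kQ → 1 ≤ proj₁ kQ × DegLe (proj₂ kQ) (proj₁ kQ ∸ d)) ks
              × LastInXQ ks

ValidD° : ℕ → List (ℕ × Poly) → Set
ValidD° d ks = ValidD d ks × All (λ kQ → InXQ (proj₂ kQ)) ks

lin : {I : Set} → (I → PS) → List (ℚ × I) → PS
lin g [] N = 0ℚ
lin g ((c , i) ∷ L) N = c * g i N + lin g L N

InSpan : {I : Set} → (I → Set) → (I → PS) → PS → Set
InSpan {I} P g f = Σ (List (ℚ × I)) λ L → All (λ ci → P (proj₂ ci)) L × (∀ N → f N ≡ lin g L N)

SameSet : (PS → Set) → (PS → Set) → Set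
SameSet A B = ∀ f → (A f → B f) × (B f → A f)

Zqd : ℕ → PS → Set
Zqd d = InSpan (ValidD d) zetaQ

Zqd° : ℕ → PS → Set
Zqd° d = InSpan (ValidD° d) zetaQ

-- Indices: 𝕀 as lists of naturals (with all entries ≥ 1), 𝕀bar with 1̄.

data BarIdx : Set where
  bar : BarIdx
  num : ℕ → BarIdx

PosIdx : List ℕ → Set
PosIdx ks = All (1 ≤_) ks

PosBarIdx : BarIdx → Set
PosBarIdx bar = ⊤
PosBarIdx (num k) = 1 ≤ k

AdmLast : List ℕ → Set
AdmLast [] = ⊤
AdmLast (k ∷ []) = ¬ (k ≡ 1)
AdmLast (_ ∷ k ∷ ks) = AdmLast (k ∷ ks)

Adm : List ℕ → Set
Adm ks = PosIdx ks × AdmLast ks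

AdmBarLast : List BarIdx → Set
AdmBarLast [] = ⊤
AdmBarLast (k ∷ []) = ¬ (k ≡ bar)
AdmBarLast (_ ∷ k ∷ ks) = AdmBarLast (k ∷ ks)

AdmBar : List BarIdx → Set
AdmBar ks = All PosBarIdx ks × AdmBarLast ks

-- q^n / (1-q^n)^k as a series in x = q^n
daggerFactor : BarIdx → PS × Bool
daggerFactor bar = (oneS , false)
daggerFactor (num k) = (polyS (0ℚ ∷ 1ℚ ∷ []) *S geomPow k , true)

zetaDagger : List BarIdx → PS
zetaDagger ks = nest (map daggerFactor ks) 0

-- x^{k-1} / (1-x)^k
xPow : ℕ → PS
xPow e m with m Data.Nat.≟ e
... | Relation.Nullary.yes _ = 1ℚ
... | Relation.Nullary.no _ = 0ℚ

zetaBZ : List ℕ → PS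
zetaBZ ks = nest (map (λ k → (xPow (k ∸ 1) *S geomPow k , true)) ks) 0

NoBar : List BarIdx → Set
NoBar ks = All (λ k → ¬ (k ≡ bar)) ks

NoOne : List ℕ → Set
NoOne ks = All (λ k → ¬ (k ≡ 1)) ks

-- Write x = q^n. The nested sum is linear in each of its factors, so it suffices to rewrite
-- single factors. Splitting Q into monomials and iterating
--   x^i / (1-x)^(k+1) = x^i / (1-x)^k + x^(i+1) / (1-x)^(k+1)
-- turns x^j / (1-x)^k with j ≤ k into a combination of x / (1-x)^a (a ≥ 1) and, for j = 0 only,
-- the constant 1; with j < k it becomes a combination of x^(a-1) / (1-x)^a with a > j.
-- A constant factor under n_i < n_(i+1) is the factor 1̄ (n_i ≤ n_(i+1)) minus the sum with the
-- variable n_i deleted; this gives ζ_q(k; Q) ∈ span ζ_q^† and, when deg Q_j ≤ k_j - 1,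
-- ζ_q(k; Q) ∈ span ζ_q^BZ. Conversely ζ_q^BZ(k) = ζ_q(k; x^(k-1)), and ζ_q^† unfolds into ζ_q with
-- Q = x, and Q = 1 - x for 1̄ by the same identity read backwards. Only nonzero constant terms
-- Q_j(0) produce 1̄ (resp. a = 1), which gives the statements for the ° spaces.

module Submission where

open import Defs
open import Function using (_∘_; id)
open import Data.Product using (_×_; Σ-syntax; _,_; proj₁; proj₂; map₁)
open import Data.Nat as ℕ using (ℕ; zero; suc; _∸_; z≤n; s≤s) renaming (_≤_ to _≤ℕ_; _<_ to _<ℕ_)
import Data.Nat.Properties as ℕP
open import Data.Nat.DivMod using (_%_; _/_; m≡m%n+[m/n]*n)
open import Data.Rational as ℚ using (ℚ; 0ℚ; 1ℚ; _+_; _*_; -_)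
import Data.Rational.Properties as ℚP
open import Data.List using (List; []; _∷_; map; _++_; applyUpTo; length)
open import Data.List.Relation.Unary.All as All using (All; []; _∷_)
open import Data.List.Relation.Unary.All.Properties using (++⁺; map⁺)
open import Data.Unit using (tt)
open import Data.Bool using (Bool; true; false; if_then_else_)
open import Relation.Nullary using (Dec; yes; no; contradiction)
open import Relation.Binary.PropositionalEquality
import Algebra.Solver.Ring.AlmostCommutativeRing as ACR
open import Algebra.Solver.Ring.Simple (ACR.fromCommutativeRing ℚP.+-*-commutativeRing) ℚ._≟_

-- Linear combinations and spans

Combination : Set → Set
Combination I = List (ℚ × I)

lincomb : {I : Set} → Combination I → (I → ℚ) → ℚ
lincomb []            v = 0ℚ
lincomb ((c , i) ∷ L) v = c * v i + lincomb L v

lincomb-unit : {I : Set} (i : I) (v : I → ℚ) → lincomb ((1ℚ , i) ∷ []) v ≡ v i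
lincomb-unit i v = trans (ℚP.+-identityʳ (1ℚ * v i)) (ℚP.*-identityˡ (v i))

scale : {I : Set} → ℚ → Combination I → Combination I
scale a = map (map₁ (a *_))

module _ {I : Set} where

  lincomb-cong : (L : Combination I) {v w : I → ℚ} → (∀ i → v i ≡ w i) → lincomb L v ≡ lincomb L w
  lincomb-cong []            v≗w = refl
  lincomb-cong ((c , i) ∷ L) v≗w = cong₂ (λ a b → c * a + b) (v≗w i) (lincomb-cong L v≗w)

  lincomb-zero : (L : Combination I) → lincomb L (λ _ → 0ℚ) ≡ 0ℚ
  lincomb-zero []            = refl
  lincomb-zero ((c , i) ∷ L) =
    trans (cong (c * 0ℚ +_) (lincomb-zero L)) (trans (ℚP.+-identityʳ (c * 0ℚ)) (ℚP.*-zeroʳ c))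

  lincomb-+ : (L : Combination I) (v w : I → ℚ) → lincomb L v + lincomb L w ≡ lincomb L (λ i → v i + w i)
  lincomb-+ []            v w = refl
  lincomb-+ ((c , i) ∷ L) v w =
    trans (ring (v i) (w i) (lincomb L v) (lincomb L w)) (cong (c * (v i + w i) +_) (lincomb-+ L v w))
    where ring : ∀ x y A B → (c * x + A) + (c * y + B) ≡ c * (x + y) + (A + B)
          ring = solve 5 (λ c x y A B → (c :* x :+ A) :+ (c :* y :+ B) := c :* (x :+ y) :+ (A :+ B)) refl c

  *-distribˡ-lincomb : (a : ℚ) (L : Combination I) (v : I → ℚ) → a * lincomb L v ≡ lincomb L (λ i → a * v i)
  *-distribˡ-lincomb a []            v = ℚP.*-zeroʳ a
  *-distribˡ-lincomb a ((c , i) ∷ L) v =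
    trans (ring (v i) (lincomb L v)) (cong (c * (a * v i) +_) (*-distribˡ-lincomb a L v))
    where ring : ∀ x A → a * (c * x + A) ≡ c * (a * x) + a * A
          ring = solve 4 (λ a c x A → a :* (c :* x :+ A) := c :* (a :* x) :+ a :* A) refl a c

  *-distribʳ-lincomb : (a : ℚ) (L : Combination I) (v : I → ℚ) → lincomb L v * a ≡ lincomb L (λ i → v i * a)
  *-distribʳ-lincomb a L v = trans (ℚP.*-comm (lincomb L v) a)
    (trans (*-distribˡ-lincomb a L v) (lincomb-cong L (λ i → ℚP.*-comm a (v i))))

  lincomb-++ : (L M : Combination I) (v : I → ℚ) → lincomb (L ++ M) v ≡ lincomb L v + lincomb M v
  lincomb-++ []            M v = sym (ℚP.+-identityˡ (lincomb M v))
  lincomb-++ ((c , i) ∷ L) M v =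
    trans (cong (c * v i +_) (lincomb-++ L M v)) (sym (ℚP.+-assoc (c * v i) (lincomb L v) (lincomb M v)))

  lincomb-scale : (a : ℚ) (L : Combination I) (v : I → ℚ) → lincomb (scale a L) v ≡ a * lincomb L v
  lincomb-scale a []            v = sym (ℚP.*-zeroʳ a)
  lincomb-scale a ((c , i) ∷ L) v = trans (cong ((a * c) * v i +_) (lincomb-scale a L v)) (ring (v i) (lincomb L v))
    where ring : ∀ x A → (a * c) * x + a * A ≡ a * (c * x + A)
          ring = solve 4 (λ a c x A → (a :* c) :* x :+ a :* A := a :* (c :* x :+ A)) refl a c

  sumℚ-lincomb : (n : ℕ) (L : Combination I) (v : ℕ → I → ℚ) →
    sumℚ (applyUpTo (λ j → lincomb L (v j)) n) ≡ lincomb L (λ i → sumℚ (applyUpTo (λ j → v j i) n))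
  sumℚ-lincomb zero    L v = sym (lincomb-zero L)
  sumℚ-lincomb (suc n) L v = trans (cong (lincomb L (v 0) +_) (sumℚ-lincomb n L (v ∘ suc))) (lincomb-+ L (v 0) _)

sumℚ-applyUpTo-cong : ∀ n {u v : ℕ → ℚ} → (∀ j → j <ℕ n → u j ≡ v j) →
  sumℚ (applyUpTo u n) ≡ sumℚ (applyUpTo v n)
sumℚ-applyUpTo-cong zero    u≗v = refl
sumℚ-applyUpTo-cong (suc n) u≗v =
  cong₂ _+_ (u≗v 0 (s≤s z≤n)) (sumℚ-applyUpTo-cong n λ j j<n → u≗v (suc j) (s≤s j<n))

sumℚ-applyUpTo-+ : ∀ n (u v : ℕ → ℚ) →
  sumℚ (applyUpTo (λ j → u j + v j) n) ≡ sumℚ (applyUpTo u n) + sumℚ (applyUpTo v n)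
sumℚ-applyUpTo-+ zero    u v = refl
sumℚ-applyUpTo-+ (suc n) u v = trans (cong (u 0 + v 0 +_) (sumℚ-applyUpTo-+ n (u ∘ suc) (v ∘ suc)))
  (solve 4 (λ a b c d → a :+ b :+ (c :+ d) := a :+ c :+ (b :+ d)) refl (u 0) (v 0) _ _)

Spanned : {I X : Set} → (I → Set) → (I → X → ℚ) → (X → ℚ) → Set
Spanned {I} P g f = Σ[ L ∈ Combination I ] All (P ∘ proj₂) L × (∀ x → f x ≡ lincomb L (λ i → g i x))

module _ {I X : Set} {P : I → Set} {g : I → X → ℚ} where

  span-gen : ∀ {i} → P i → Spanned P g (g i)
  span-gen {i} Pi = (1ℚ , i) ∷ [] , Pi ∷ [] , λ x → sym (lincomb-unit i (λ i → g i x))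

  span-∷ : ∀ {i} (c : ℚ) {f : X → ℚ} → P i → Spanned P g f → Spanned P g (λ x → c * g i x + f x)
  span-∷ {i} c Pi (L , PL , f≗L) = (c , i) ∷ L , Pi ∷ PL , λ x → cong (c * g i x +_) (f≗L x)

  span-resp : {f f′ : X → ℚ} → (∀ x → f x ≡ f′ x) → Spanned P g f → Spanned P g f′
  span-resp f≗f′ (L , PL , f≗L) = L , PL , λ x → trans (sym (f≗f′ x)) (f≗L x)

  span-mono : {P′ : I → Set} {f : X → ℚ} → (∀ {i} → P i → P′ i) → Spanned P g f → Spanned P′ g f
  span-mono P⊆P′ (L , PL , f≗L) = L , All.map P⊆P′ PL , f≗L

  span-+ : {f f′ : X → ℚ} → Spanned P g f → Spanned P g f′ → Spanned P g (λ x → f x + f′ x)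
  span-+ (L , PL , f≗L) (M , PM , f′≗M) =
    L ++ M , ++⁺ PL PM , λ x → trans (cong₂ _+_ (f≗L x) (f′≗M x)) (sym (lincomb-++ L M _))

  span-scale : (a : ℚ) {f : X → ℚ} → Spanned P g f → Spanned P g (λ x → a * f x)
  span-scale a (L , PL , f≗L) = scale a L , map⁺ PL , λ x → trans (cong (a *_) (f≗L x)) (sym (lincomb-scale a L _))

module _ {I J X : Set} {P : I → Set} {g : I → X → ℚ} where

  span-bind : {P′ : J → Set} {h : J → X → ℚ} {f : X → ℚ} →
    Spanned P g f → (∀ i → P i → Spanned P′ h (g i)) → Spanned P′ h f
  span-bind {P′ = P′} {h} (L , PL , f≗L) g∈ = span-resp (λ x → sym (f≗L x)) (go L PL)
    where
    go : (L : Combination I) → All (P ∘ proj₂) L → Spanned P′ h (λ x → lincomb L (λ i → g i x))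
    go []            []        = [] , [] , λ _ → refl
    go ((c , i) ∷ L) (Pi ∷ PL) = span-+ (span-scale c (g∈ i Pi)) (go L PL)

  span-reindex : {P′ : J → Set} {h : J → X → ℚ} {f : X → ℚ} (t : I → J) →
    (∀ {i} → P i → P′ (t i)) → (∀ i x → h (t i) x ≡ g i x) → Spanned P g f → Spanned P′ h f
  span-reindex t P⇒P′ h∘t≗g f∈ = span-bind f∈ (λ i Pi → span-resp (h∘t≗g i) (span-gen (P⇒P′ Pi)))

Linear : {X Y : Set} → ((X → ℚ) → (Y → ℚ)) → Set₁
Linear {X} Φ = ∀ {I : Set} (L : Combination I) (g : I → X → ℚ) (f : X → ℚ) →
  (∀ x → f x ≡ lincomb L (λ i → g i x)) → ∀ y → Φ f y ≡ lincomb L (λ i → Φ (g i) y)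

module _ {X Y : Set} where

  span-map : {I : Set} {P : I → Set} {g : I → X → ℚ} {f : X → ℚ} {Φ : (X → ℚ) → (Y → ℚ)} →
    Linear Φ → Spanned P g f → Spanned P (Φ ∘ g) (Φ f)
  span-map {g = g} {f} Φ-lin (L , PL , f≗L) = L , PL , Φ-lin L g f f≗L

  linear-cong : {Φ : (X → ℚ) → (Y → ℚ)} → Linear Φ →
    {f f′ : X → ℚ} → (∀ x → f x ≡ f′ x) → ∀ y → Φ f y ≡ Φ f′ y
  linear-cong {Φ} Φ-lin {f} {f′} f≗f′ y =
    trans (Φ-lin ((1ℚ , f′) ∷ []) id f (λ x → trans (f≗f′ x) (sym (lincomb-unit f′ (λ h → h x)))) y)
          (lincomb-unit f′ (λ h → Φ h y))

  linear-at : (σ : Y → X) → Linear (λ f → f ∘ σ)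
  linear-at σ L g f f≗L y = f≗L (σ y)

  linear-scaleˡ : (a : Y → ℚ) {Φ : (X → ℚ) → (Y → ℚ)} → Linear Φ → Linear (λ f y → a y * Φ f y)
  linear-scaleˡ a Φ-lin L g f f≗L y = trans (cong (a y *_) (Φ-lin L g f f≗L y)) (*-distribˡ-lincomb (a y) L _)

  linear-scaleʳ : (a : Y → ℚ) {Φ : (X → ℚ) → (Y → ℚ)} → Linear Φ → Linear (λ f y → Φ f y * a y)
  linear-scaleʳ a Φ-lin L g f f≗L y = trans (cong (_* a y) (Φ-lin L g f f≗L y)) (*-distribʳ-lincomb (a y) L _)

  linear-sum : (n : Y → ℕ) (Φ : ℕ → (X → ℚ) → (Y → ℚ)) → (∀ j → Linear (Φ j)) →
    Linear (λ f y → sumℚ (applyUpTo (λ j → Φ j f y) (n y)))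
  linear-sum n Φ Φ-lin L g f f≗L y =
    trans (sumℚ-applyUpTo-cong (n y) (λ j _ → Φ-lin j L g f f≗L y))
          (sumℚ-lincomb (n y) L (λ j i → Φ j (g i) y))

-- Power series

shift : ℕ → PS → PS
shift zero    f m       = f m
shift (suc i) f zero    = 0ℚ
shift (suc i) f (suc m) = shift i f m

shift-linear : ∀ i → Linear (shift i)
shift-linear zero    L g f f≗L m       = f≗L m
shift-linear (suc i) L g f f≗L zero    = sym (lincomb-zero L)
shift-linear (suc i) L g f f≗L (suc m) = shift-linear i L g f f≗L m

shift-+ : ∀ i {f g h : PS} → (∀ m → f m ≡ g m + h m) → ∀ m → shift i f m ≡ shift i g m + shift i h m
shift-+ zero    f≗g+h m       = f≗g+h m
shift-+ (suc i) f≗g+h zero    = refl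
shift-+ (suc i) f≗g+h (suc m) = shift-+ i f≗g+h m

shift-shift : ∀ i f m → shift i (shift 1 f) m ≡ shift (suc i) f m
shift-shift zero    f m       = refl
shift-shift (suc i) f zero    = refl
shift-shift (suc i) f (suc m) = shift-shift i f m

xPow-≢ : ∀ e m → m ≢ e → xPow e m ≡ 0ℚ
xPow-≢ e m m≢e with m ℕ.≟ e
... | yes m≡e = contradiction m≡e m≢e
... | no _    = refl

xPow-suc-suc : ∀ e m → xPow (suc e) (suc m) ≡ xPow e m
xPow-suc-suc e m with m ℕ.≟ e | suc m ℕ.≟ suc e
... | yes _   | yes _    = refl
... | no _    | no _     = refl
... | yes m≡e | no m≢e   = contradiction (cong suc m≡e) m≢e
... | no m≢e  | yes m≡e  = contradiction (ℕP.suc-injective m≡e) m≢e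

shift-xPow : ∀ i e m → shift i (xPow e) m ≡ xPow (i ℕ.+ e) m
shift-xPow zero    e m       = refl
shift-xPow (suc i) e zero    = sym (xPow-≢ (suc (i ℕ.+ e)) 0 λ ())
shift-xPow (suc i) e (suc m) = trans (shift-xPow i e m) (sym (xPow-suc-suc (i ℕ.+ e) m))

*S-linearˡ : (G : PS) → Linear (_*S G)
*S-linearˡ G = linear-sum suc _ λ i → linear-scaleʳ (λ N → G (N ∸ i)) (linear-at (λ _ → i))

*S-zeroˡ : {F : PS} (G : PS) → (∀ i → F i ≡ 0ℚ) → ∀ N → (F *S G) N ≡ 0ℚ
*S-zeroˡ G F≗0 = *S-linearˡ G {I = ℚ} [] (λ _ _ → 0ℚ) _ F≗0

*S-unitˡ : {F : PS} (G : PS) → F 0 ≡ 1ℚ → (∀ i → F (suc i) ≡ 0ℚ) → ∀ N → (F *S G) N ≡ G N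
*S-unitˡ G F0≡1 F+≡0 zero    =
  trans (cong (λ a → a * G 0 + 0ℚ) F0≡1) (trans (ℚP.+-identityʳ _) (ℚP.*-identityˡ (G 0)))
*S-unitˡ G F0≡1 F+≡0 (suc N) =
  trans (cong₂ (λ a b → a * G (suc N) + b) F0≡1 (*S-zeroˡ G F+≡0 N))
        (trans (ℚP.+-identityʳ _) (ℚP.*-identityˡ (G (suc N))))

xPow-*S : ∀ e G N → (xPow e *S G) N ≡ shift e G N
xPow-*S zero    G N       = *S-unitˡ {xPow 0} G refl (λ i → xPow-≢ 0 (suc i) λ ()) N
xPow-*S (suc e) G zero    = solve 1 (λ a → con 0ℚ :* a :+ con 0ℚ := con 0ℚ) refl (G 0)
xPow-*S (suc e) G (suc N) =
  trans (cong₂ (λ a b → a * G (suc N) + b) (xPow-≢ (suc e) 0 λ ())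
               (trans (linear-cong (*S-linearˡ G) (xPow-suc-suc e) N) (xPow-*S e G N)))
        (solve 2 (λ a b → con 0ℚ :* a :+ b := b) refl (G (suc N)) (shift e G N))

geomPow-suc : ∀ k m → geomPow (suc k) m ≡ geomPow k m + shift 1 (geomPow (suc k)) m
geomPow-suc k zero    = cong (_+ 0ℚ) (ℚP.*-identityˡ (geomPow k 0))
geomPow-suc k (suc m) = cong (_+ geomPow (suc k) m) (ℚP.*-identityˡ (geomPow k (suc m)))

frac : ℕ → ℕ → PS
frac i k = shift i (geomPow k)

frac-split : ∀ i k m → frac i (suc k) m ≡ frac i k m + frac (suc i) (suc k) m
frac-split i k m = trans (shift-+ i (geomPow-suc k) m) (cong (frac i k m +_) (shift-shift i (geomPow (suc k)) m))

polyS-span : ∀ Q → Spanned (λ j → j <ℕ length Q × (InXQ Q → 1 ≤ℕ j)) xPow (polyS Q)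
polyS-span [] = [] , [] , λ _ → refl
polyS-span (c ∷ cs) = add-constant (c ℚ.≟ 0ℚ)
  where
  P : ℕ → Set
  P j = j <ℕ suc (length cs) × (InXQ (c ∷ cs) → 1 ≤ℕ j)

  tail : Spanned P xPow (shift 1 (polyS cs))
  tail = span-reindex suc (λ (j< , _) → s≤s j< , λ _ → s≤s z≤n) (λ j m → sym (shift-xPow 1 j m))
           (span-map (shift-linear 1) (polyS-span cs))

  add-constant : Dec (c ≡ 0ℚ) → Spanned P xPow (polyS (c ∷ cs))
  add-constant (yes c≡0) = span-resp head tail
    where
    head : ∀ m → shift 1 (polyS cs) m ≡ polyS (c ∷ cs) m
    head zero    = sym c≡0
    head (suc m) = refl
  add-constant (no c≢0) = span-resp head (span-∷ c (s≤s z≤n , λ c≡0 → contradiction c≡0 c≢0) tail)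
    where
    head : ∀ m → c * xPow 0 m + shift 1 (polyS cs) m ≡ polyS (c ∷ cs) m
    head zero    = solve 1 (λ c → c :* con 1ℚ :+ con 0ℚ := c) refl c
    head (suc m) = solve 2 (λ c a → c :* con 0ℚ :+ a := a) refl c (polyS cs m)

monomial : ℕ → Poly
monomial zero    = 1ℚ ∷ []
monomial (suc e) = 0ℚ ∷ monomial e

length-monomial : ∀ e → length (monomial e) ≡ suc e
length-monomial zero    = refl
length-monomial (suc e) = cong suc (length-monomial e)

polyS-monomial : ∀ e m → polyS (monomial e) m ≡ xPow e m
polyS-monomial zero    zero    = refl
polyS-monomial zero    (suc m) = sym (xPow-≢ 0 (suc m) λ ())
polyS-monomial (suc e) zero    = sym (xPow-≢ (suc e) 0 λ ())
polyS-monomial (suc e) (suc m) = trans (polyS-monomial e m) (sym (xPow-suc-suc e m))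

oneS-factor : ∀ m → oneS m ≡ factor (1 , 1ℚ ∷ - 1ℚ ∷ []) m
oneS-factor m = sym (begin
  factor (1 , 1ℚ ∷ - 1ℚ ∷ []) m
    ≡⟨ *S-linearˡ (geomPow 1) ((1ℚ , 0) ∷ (- 1ℚ , 1) ∷ []) xPow _ 1-x m ⟩
  1ℚ * (xPow 0 *S geomPow 1) m + (- 1ℚ * (xPow 1 *S geomPow 1) m + 0ℚ)
    ≡⟨ cong₂ (λ a b → 1ℚ * a + (- 1ℚ * b + 0ℚ)) (xPow-*S 0 (geomPow 1) m) (xPow-*S 1 (geomPow 1) m) ⟩
  1ℚ * geomPow 1 m + (- 1ℚ * shift 1 (geomPow 1) m + 0ℚ)
    ≡⟨ cong (λ a → 1ℚ * a + (- 1ℚ * shift 1 (geomPow 1) m + 0ℚ)) (geomPow-suc 0 m) ⟩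
  1ℚ * (oneS m + shift 1 (geomPow 1) m) + (- 1ℚ * shift 1 (geomPow 1) m + 0ℚ)
    ≡⟨ solve 2 (λ a b → con 1ℚ :* (a :+ b) :+ (con (- 1ℚ) :* b :+ con 0ℚ) := a) refl
               (oneS m) (shift 1 (geomPow 1) m) ⟩
  oneS m ∎)
  where
  open ≡-Reasoning
  1-x : ∀ n → polyS (1ℚ ∷ - 1ℚ ∷ []) n ≡ 1ℚ * xPow 0 n + (- 1ℚ * xPow 1 n + 0ℚ)
  1-x zero          = refl
  1-x (suc zero)    = refl
  1-x (suc (suc n)) = refl

linear-dil : {Y : Set} (p m : Y → ℕ) → Linear (λ f y → dil (p y) f (m y))
linear-dil p m L g f f≗L y with m y % suc (p y)
... | zero  = f≗L (m y / suc (p y))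
... | suc _ = sym (lincomb-zero L)

dil-oneS : ∀ p m → dil p oneS m ≡ oneS m
dil-oneS p zero = refl
dil-oneS p (suc m) with suc m % suc p in r≡
... | suc _ = refl
... | zero  = oneS-≢0 {suc m / suc p} λ q≡0 →
  contradiction (trans (m≡m%n+[m/n]*n (suc m) (suc p)) (cong₂ (λ r q → r ℕ.+ q ℕ.* suc p) r≡ q≡0)) λ ()
  where
  oneS-≢0 : ∀ {q} → q ≢ 0 → oneS q ≡ 0ℚ
  oneS-≢0 {zero}  q≢0 = contradiction refl q≢0
  oneS-≢0 {suc q} q≢0 = refl

-- Nested sums

sumRange-cong : ∀ lo N {u v : ℕ → ℚ} → (∀ p → p ≤ℕ N → u p ≡ v p) →
  sumRange lo N u ≡ sumRange lo N v
sumRange-cong lo N u≗v = sumℚ-applyUpTo-cong (suc N ∸ lo) λ i i< → u≗v (lo ℕ.+ i) (ℕP.≤-pred (bound lo i< ))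
  where
  bound : ∀ lo {i n} → i <ℕ n ∸ lo → lo ℕ.+ i <ℕ n
  bound zero    i<n = i<n
  bound (suc lo) {n = suc n} i< = s≤s (bound lo i<)

sumRange-+ : ∀ lo N (u v : ℕ → ℚ) → sumRange lo N (λ p → u p + v p) ≡ sumRange lo N u + sumRange lo N v
sumRange-+ lo N u v = sumℚ-applyUpTo-+ (suc N ∸ lo) (λ i → u (lo ℕ.+ i)) (λ i → v (lo ℕ.+ i))

sumRange-head : ∀ p N (h : ℕ → ℚ) → p ≤ℕ N → sumRange p N h ≡ h p + sumRange (suc p) N h
sumRange-head p N h p≤N =
  trans (cong (λ n → sumℚ (applyUpTo (λ i → h (p ℕ.+ i)) n)) (ℕP.+-∸-assoc 1 p≤N))
        (cong₂ _+_ (cong h (ℕP.+-identityʳ p)) (sumℚ-applyUpTo-cong (N ∸ p) λ i _ → cong h (ℕP.+-suc p i)))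

sumRange-tails : ∀ lo N (h : ℕ → ℚ) →
  sumRange lo N (λ p → sumRange p N h) ≡ sumRange lo N (λ p → sumRange (suc p) N h) + sumRange lo N h
sumRange-tails lo N h =
  trans (sumRange-cong lo N (λ p → sumRange-head p N h))
        (trans (sumRange-+ lo N h (λ p → sumRange (suc p) N h)) (ℚP.+-comm (sumRange lo N h) _))

nested : List (PS × Bool) → ℕ × ℕ → ℚ
nested E y = nest E (proj₁ y) (proj₂ y)

next : Bool → ℕ → ℕ
next s p = if s then suc p else p

-- nested ((f , s) ∷ E) is definitionally extend f s (nested E).
extend : PS → Bool → (ℕ × ℕ → ℚ) → ℕ × ℕ → ℚ
extend f s R y = sumRange (proj₁ y) (proj₂ y) (λ p → (dil p f *S (λ m → R (next s p , m))) (proj₂ y))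

extend-linearʳ : ∀ f s → Linear (extend f s)
extend-linearʳ f s =
  linear-sum (λ y → suc (proj₂ y) ∸ proj₁ y) _ λ i →
  linear-sum (λ y → suc (proj₂ y)) _ λ j →
  linear-scaleˡ (λ y → dil (proj₁ y ℕ.+ i) f j) (linear-at (λ y → next s (proj₁ y ℕ.+ i) , proj₂ y ∸ j))

extend-linearˡ : ∀ s R → Linear (λ f → extend f s R)
extend-linearˡ s R =
  linear-sum (λ y → suc (proj₂ y) ∸ proj₁ y) _ λ i →
  linear-sum (λ y → suc (proj₂ y)) _ λ j →
  linear-scaleʳ (λ y → R (next s (proj₁ y ℕ.+ i) , proj₂ y ∸ j))
                (linear-dil (λ y → proj₁ y ℕ.+ i) (λ _ → j))

extend-cong : ∀ s {f f′ R R′} → (∀ m → f m ≡ f′ m) → (∀ x → R x ≡ R′ x) →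
  ∀ y → extend f s R y ≡ extend f′ s R′ y
extend-cong s {f′ = f′} {R} f≗f′ R≗R′ y =
  trans (linear-cong (extend-linearˡ s R) f≗f′ y) (linear-cong (extend-linearʳ f′ s) R≗R′ y)

module _ {I : Set} {P : I → Set} where

  nested-head-span : {h : I → PS} {f : PS} → ∀ s E →
    Spanned P h f → Spanned P (λ i → nested ((h i , s) ∷ E)) (nested ((f , s) ∷ E))
  nested-head-span s E = span-map (extend-linearˡ s (nested E))

  nested-tail-span : {T : I → List (PS × Bool)} {E : List (PS × Bool)} → ∀ f s →
    Spanned P (nested ∘ T) (nested E) → Spanned P (λ i → nested ((f , s) ∷ T i)) (nested ((f , s) ∷ E))
  nested-tail-span f s = span-map (extend-linearʳ f s)

extend-oneS : ∀ s R y → extend oneS s R y ≡ sumRange (proj₁ y) (proj₂ y) (λ p → R (next s p , proj₂ y))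
extend-oneS s R (lo , N) = sumRange-cong lo N λ p _ →
  trans (linear-cong (*S-linearˡ (λ m → R (next s p , m))) (dil-oneS p) N)
        (*S-unitˡ {oneS} (λ m → R (next s p , m)) refl (λ _ → refl) N)

-- The tail must be nonempty: nest cuts every sum off at p ≤ N, and only a nonempty tail
-- (which vanishes when started beyond N) makes this cut-off harmless.
nested-bar : ∀ g s E y →
  nested ((oneS , false) ∷ (g , s) ∷ E) y ≡ nested ((oneS , true) ∷ (g , s) ∷ E) y + nested ((g , s) ∷ E) y
nested-bar g s E (lo , N) = begin
  extend oneS false (nested ((g , s) ∷ E)) (lo , N)
    ≡⟨ extend-oneS false (nested ((g , s) ∷ E)) (lo , N) ⟩
  sumRange lo N (λ p → sumRange p N h)
    ≡⟨ sumRange-tails lo N h ⟩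
  sumRange lo N (λ p → sumRange (suc p) N h) + sumRange lo N h
    ≡⟨ cong (_+ sumRange lo N h) (extend-oneS true (nested ((g , s) ∷ E)) (lo , N)) ⟨
  extend oneS true (nested ((g , s) ∷ E)) (lo , N) + sumRange lo N h ∎
  where
  open ≡-Reasoning
  h : ℕ → ℚ
  h p = (dil p g *S nest E (next s p)) N

-- Expanding a single factor

daggerFactor-num : ∀ a m → proj₁ (daggerFactor (num a)) m ≡ frac 1 a m
daggerFactor-num a m = trans (linear-cong (*S-linearˡ (geomPow a)) (polyS-monomial 1) m) (xPow-*S 1 (geomPow a) m)

frac0-span : ∀ k → Spanned PosBarIdx (proj₁ ∘ daggerFactor) (frac 0 k)
frac0-span zero    = span-gen {i = bar} _
frac0-span (suc k) = span-resp (λ m → sym (frac-split 0 k m))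
  (span-+ (frac0-span k) (span-resp (daggerFactor-num (suc k)) (span-gen {i = num (suc k)} (s≤s z≤n))))

frac-pos-span : ∀ j k → 1 ≤ℕ j → j ≤ℕ k → Spanned (1 ≤ℕ_) (frac 1) (frac j k)
frac-pos-span (suc zero)    k       _ 1≤k         = span-gen 1≤k
frac-pos-span (suc (suc j)) (suc k) _ (s≤s j+1≤k) =
  span-resp difference (span-+ (frac-pos-span (suc j) (suc k) (s≤s z≤n) (ℕP.m≤n⇒m≤1+n j+1≤k))
                               (span-scale (- 1ℚ) (frac-pos-span (suc j) k (s≤s z≤n) j+1≤k)))
  where
  difference : ∀ m → frac (suc j) (suc k) m + - 1ℚ * frac (suc j) k m ≡ frac (suc (suc j)) (suc k) m
  difference m rewrite frac-split (suc j) k m =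
    solve 2 (λ b c → b :+ c :+ con (- 1ℚ) :* b := c) refl (frac (suc j) k m) (frac (suc (suc j)) (suc k) m)

frac-dagger-span : ∀ j k → j ≤ℕ k →
  Spanned (λ x → PosBarIdx x × (1 ≤ℕ j → x ≢ bar)) (proj₁ ∘ daggerFactor) (frac j k)
frac-dagger-span zero    k _   = span-mono (λ pos → pos , λ ()) (frac0-span k)
frac-dagger-span (suc j) k j≤k =
  span-reindex num (λ 1≤a → 1≤a , λ _ ()) daggerFactor-num (frac-pos-span (suc j) k (s≤s z≤n) j≤k)

factor-dagger-span : ∀ k Q → DegLe Q k →
  Spanned (λ x → PosBarIdx x × (InXQ Q → x ≢ bar)) (proj₁ ∘ daggerFactor) (factor (k , Q))
factor-dagger-span k Q deg =
  span-bind (span-map (*S-linearˡ (geomPow k)) (polyS-span Q)) λ j (j<len , inXQ⇒1≤j) →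
  span-resp (λ m → sym (xPow-*S j (geomPow k) m))
    (span-mono (λ (pos , 1≤j⇒≢bar) → pos , 1≤j⇒≢bar ∘ inXQ⇒1≤j)
      (frac-dagger-span j k (ℕP.≤-pred (ℕP.≤-trans j<len deg))))

bzFactor : ℕ → PS
bzFactor a = xPow (a ∸ 1) *S geomPow a

bzFrac : ℕ → PS
bzFrac a = frac (a ∸ 1) a

frac-bz-span : ∀ d j → Spanned (j <ℕ_) bzFrac (frac j (suc (d ℕ.+ j)))
frac-bz-span zero    j = span-gen {i = suc j} ℕP.≤-refl
frac-bz-span (suc d) j = span-resp (λ m → sym (frac-split j (suc (d ℕ.+ j)) m))
  (span-+ (frac-bz-span d j) (span-mono ℕP.<⇒≤ shifted))
  where
  shifted : Spanned (suc j <ℕ_) bzFrac (frac (suc j) (suc (suc (d ℕ.+ j))))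
  shifted = subst (λ k → Spanned (suc j <ℕ_) bzFrac (frac (suc j) (suc k))) (ℕP.+-suc d j) (frac-bz-span d (suc j))

factor-bz-span : ∀ k Q → 1 ≤ℕ k → DegLe Q (k ∸ 1) →
  Spanned (λ a → 1 ≤ℕ a × (InXQ Q → 2 ≤ℕ a)) bzFactor (factor (k , Q))
factor-bz-span (suc k) Q _ deg =
  span-bind (span-map (*S-linearˡ (geomPow (suc k))) (polyS-span Q)) λ j (j<len , inXQ⇒1≤j) →
  span-resp (λ m → sym (xPow-*S j (geomPow (suc k)) m))
    (span-reindex id (λ j<a → ℕP.≤-trans (s≤s z≤n) j<a , λ inXQ → ℕP.≤-trans (s≤s (inXQ⇒1≤j inXQ)) j<a)
      (λ a → xPow-*S (a ∸ 1) (geomPow a))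
      (subst (Spanned (j <ℕ_) bzFrac ∘ frac j) (distance (ℕP.≤-trans j<len deg)) (frac-bz-span (k ∸ j) j)))
  where
  distance : ∀ {j} → j <ℕ suc k → suc (k ∸ j ℕ.+ j) ≡ suc k
  distance (s≤s j≤k) = cong suc (ℕP.m∸n+n≡m j≤k)

-- Expanding nested sums

AdmBar-∷ : ∀ {x D} → PosBarIdx x → (D ≡ [] → x ≢ bar) → AdmBar D → AdmBar (x ∷ D)
AdmBar-∷ {D = []}    pos ≢bar _             = pos ∷ [] , ≢bar refl
AdmBar-∷ {D = _ ∷ _} pos _    (posD , last) = pos ∷ posD , last

AdmBar-tail : ∀ {x D} → AdmBar (x ∷ D) → AdmBar D
AdmBar-tail {D = []}    _               = [] , tt
AdmBar-tail {D = _ ∷ _} (_ ∷ pos , last) = pos , last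

Adm-∷ : ∀ {a D} → 1 ≤ℕ a → (D ≡ [] → a ≢ 1) → Adm D → Adm (a ∷ D)
Adm-∷ {D = []}    pos ≢1 _             = pos ∷ [] , ≢1 refl
Adm-∷ {D = _ ∷ _} pos _  (posD , last) = pos ∷ posD , last

LastInXQ-∷ : ∀ {k} Q ks → (ks ≡ [] → InXQ Q) → LastInXQ ks → LastInXQ ((k , Q) ∷ ks)
LastInXQ-∷ _ []      inXQ _    = inXQ refl
LastInXQ-∷ _ (_ ∷ _) _    last = last

ValidD-∷ : ∀ {d k Q} ks → 1 ≤ℕ k → DegLe Q (k ∸ d) → (ks ≡ [] → InXQ Q) →
  ValidD d ks → ValidD d ((k , Q) ∷ ks)
ValidD-∷ {Q = Q} ks 1≤k deg inXQ (valid , last) = (1≤k , deg) ∷ valid , LastInXQ-∷ Q ks inXQ last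

LastInXQ-tail : ∀ kQ ks → LastInXQ (kQ ∷ ks) → LastInXQ ks
LastInXQ-tail _ []      _    = tt
LastInXQ-tail _ (_ ∷ _) last = last

zetaEntry : ℕ × Poly → PS × Bool
zetaEntry kQ = (factor kQ , true)

prepend-dagger : ∀ k Q → DegLe Q k → ∀ D → AdmBar D → (D ≡ [] → InXQ Q) →
  Spanned (λ D′ → AdmBar D′ × D′ ≢ [] × (InXQ Q → NoBar D → NoBar D′))
          (nested ∘ map daggerFactor) (nested (zetaEntry (k , Q) ∷ map daggerFactor D))
prepend-dagger k Q deg D adm last =
  span-bind (nested-head-span true (map daggerFactor D) (factor-dagger-span k Q deg)) (prepend-one D adm last)
  where
  prepend-one : ∀ D → AdmBar D → (D ≡ [] → InXQ Q) → ∀ x → PosBarIdx x × (InXQ Q → x ≢ bar) →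
    Spanned (λ D′ → AdmBar D′ × D′ ≢ [] × (InXQ Q → NoBar D → NoBar D′))
            (nested ∘ map daggerFactor) (nested ((proj₁ (daggerFactor x) , true) ∷ map daggerFactor D))
  prepend-one D adm _ (num a) (1≤a , _) =
    span-gen (AdmBar-∷ 1≤a (λ _ ()) adm , (λ ()) , λ _ noD → (λ ()) ∷ noD)
  prepend-one [] _ last bar (_ , inXQ⇒≢bar) = contradiction refl (inXQ⇒≢bar (last refl))
  prepend-one (d ∷ D) adm _ bar (_ , inXQ⇒≢bar) =
    span-resp strict-one
      (span-+ (span-gen (AdmBar-∷ tt (λ ()) adm , (λ ()) , λ inXQ _ → contradiction refl (inXQ⇒≢bar inXQ)))
              (span-scale (- 1ℚ) (span-gen (adm , (λ ()) , λ _ noD → noD))))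
    where
    E = map daggerFactor (d ∷ D)
    strict-one : ∀ y → nested (daggerFactor bar ∷ E) y + - 1ℚ * nested E y ≡ nested ((oneS , true) ∷ E) y
    strict-one y =
      trans (cong (λ a → a + - 1ℚ * nested E y)
                  (nested-bar (proj₁ (daggerFactor d)) (proj₂ (daggerFactor d)) (map daggerFactor D) y))
      (solve 2 (λ a b → a :+ b :+ con (- 1ℚ) :* b := a) refl (nested ((oneS , true) ∷ E) y) (nested E y))

bzEntry : ℕ → PS × Bool
bzEntry a = (bzFactor a , true)

prepend-bz : ∀ k Q → 1 ≤ℕ k → DegLe Q (k ∸ 1) → ∀ D → Adm D → (D ≡ [] → InXQ Q) →
  Spanned (λ D′ → Adm D′ × D′ ≢ [] × (InXQ Q → NoOne D → NoOne D′))
          (nested ∘ map bzEntry) (nested (zetaEntry (k , Q) ∷ map bzEntry D))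
prepend-bz k Q 1≤k deg D adm last =
  span-reindex (_∷ D)
    (λ (1≤a , inXQ⇒2≤a) → Adm-∷ 1≤a (λ D≡[] → ℕP.>⇒≢ (inXQ⇒2≤a (last D≡[]))) adm , (λ ()) ,
                          λ inXQ noD → ℕP.>⇒≢ (inXQ⇒2≤a inXQ) ∷ noD)
    (λ _ _ → refl)
    (nested-head-span true (map bzEntry D) (factor-bz-span k Q 1≤k deg))

-- The invariant D ≡ [] → ks ≡ [] lets prepend assume Q ∈ Xℚ[X] when D = [], so that it never
-- produces a constant factor in last position, where it could not be traded for 1̄.
module Expansion {J : Set} (entry : J → PS × Bool) (d : ℕ)
  (Admissible Circ : List J → Set) (admissible[] : Admissible []) (circ[] : Circ [])
  (prepend : ∀ k Q → 1 ≤ℕ k → DegLe Q (k ∸ d) → ∀ D → Admissible D → (D ≡ [] → InXQ Q) →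
    Spanned (λ D′ → Admissible D′ × D′ ≢ [] × (InXQ Q → Circ D → Circ D′))
            (nested ∘ map entry) (nested (zetaEntry (k , Q) ∷ map entry D)))
  where

  nested-zeta-span : ∀ ks → ValidD d ks →
    Spanned (λ D → Admissible D × (All (InXQ ∘ proj₂) ks → Circ D) × (D ≡ [] → ks ≡ []))
            (nested ∘ map entry) (nested (map zetaEntry ks))
  nested-zeta-span []             _                            = span-gen (admissible[] , (λ _ → circ[]) , λ _ → refl)
  nested-zeta-span ((k , Q) ∷ ks) ((1≤k , deg) ∷ valid , last) =
    span-bind (nested-tail-span {T = map entry} {map zetaEntry ks} (factor (k , Q)) true
                (nested-zeta-span ks (valid , LastInXQ-tail (k , Q) ks last)))
      λ D (adm , circ , D≡[]⇒ks≡[]) →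
      span-mono (λ (adm′ , D′≢[] , circ′) →
                   adm′ , (λ { (inXQ ∷ allInXQ) → circ′ inXQ (circ allInXQ) }) , λ D′≡[] → contradiction D′≡[] D′≢[])
        (prepend k Q 1≤k deg D adm λ D≡[] → subst (λ ks → LastInXQ ((k , Q) ∷ ks)) (D≡[]⇒ks≡[] D≡[]) last)

  zetaQ-span : ∀ ks → ValidD d ks →
    Spanned (λ D → Admissible D × (All (InXQ ∘ proj₂) ks → Circ D)) (λ D N → nest (map entry D) 0 N) (zetaQ ks)
  zetaQ-span ks valid =
    span-mono (λ (adm , circ , _) → adm , circ) (span-map (linear-at (0 ,_)) (nested-zeta-span ks valid))

-- ks ≡ [] → D ≡ [] ensures that the factor (1 , 1 - x) prepended for a 1̄ is never last.
ZetaTermOf : List BarIdx → List (ℕ × Poly) → Set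
ZetaTermOf D ks = ValidD 0 ks × (NoBar D → All (InXQ ∘ proj₂) ks) × (ks ≡ [] → D ≡ [])

prepend-num-span : ∀ {k} D → 1 ≤ℕ k →
  Spanned (ZetaTermOf D) (nested ∘ map zetaEntry) (nested (map daggerFactor D)) →
  Spanned (ZetaTermOf (num k ∷ D)) (nested ∘ map zetaEntry) (nested (map daggerFactor (num k ∷ D)))
prepend-num-span {k} D 1≤k D-span =
  span-reindex ((k , monomial 1) ∷_)
    (λ {ks} (valid , allInXQ , _) →
       ValidD-∷ {0} ks 1≤k (s≤s 1≤k) (λ _ → refl) valid ,
       (λ { (_ ∷ noBar) → refl ∷ allInXQ noBar }) , λ ())
    (λ _ _ → refl)
    (nested-tail-span {T = map zetaEntry} {map daggerFactor D} (proj₁ (daggerFactor (num k))) true D-span)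

prepend-bar-span : ∀ d D →
  Spanned (ZetaTermOf (d ∷ D)) (nested ∘ map zetaEntry) (nested (map daggerFactor (d ∷ D))) →
  Spanned (ZetaTermOf (bar ∷ d ∷ D)) (nested ∘ map zetaEntry) (nested (map daggerFactor (bar ∷ d ∷ D)))
prepend-bar-span d D D-span =
  span-resp (λ y → sym (nested-bar (proj₁ (daggerFactor d)) (proj₂ (daggerFactor d)) (map daggerFactor D) y))
    (span-+ strict-one-span (span-mono (λ (valid , _ , ks≡[]⇒) → valid , barred , nonempty ks≡[]⇒) D-span))
  where
  E = map daggerFactor (d ∷ D)

  barred : ∀ {A : Set} → NoBar (bar ∷ d ∷ D) → A
  barred (bar≢bar ∷ _) = contradiction refl bar≢bar

  nonempty : ∀ {ks} → (ks ≡ [] → d ∷ D ≡ []) → ks ≡ [] → bar ∷ d ∷ D ≡ []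
  nonempty ks≡[]⇒ ks≡[] = contradiction (ks≡[]⇒ ks≡[]) λ ()

  strict-one-span : Spanned (ZetaTermOf (bar ∷ d ∷ D)) (nested ∘ map zetaEntry) (nested ((oneS , true) ∷ E))
  strict-one-span =
    span-resp (extend-cong true {R = nested E} {nested E} (λ m → sym (oneS-factor m)) (λ _ → refl))
      (span-reindex ((1 , 1ℚ ∷ - 1ℚ ∷ []) ∷_)
        (λ {ks} (valid , _ , ks≡[]⇒) →
           ValidD-∷ {0} ks (s≤s z≤n) (s≤s (s≤s z≤n)) (λ ks≡[] → contradiction (nonempty ks≡[]⇒ ks≡[]) λ ())
                    valid ,
           barred , λ ())
        (λ _ _ → refl)
        (nested-tail-span {T = map zetaEntry} {E} (factor (1 , 1ℚ ∷ - 1ℚ ∷ [])) true D-span))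

nested-dagger-span : ∀ D → AdmBar D →
  Spanned (ZetaTermOf D) (nested ∘ map zetaEntry) (nested (map daggerFactor D))
nested-dagger-span []            _                = span-gen (([] , tt) , (λ _ → []) , λ _ → refl)
nested-dagger-span (num k ∷ D)   adm@(1≤k ∷ _ , _) = prepend-num-span D 1≤k (nested-dagger-span D (AdmBar-tail adm))
nested-dagger-span (bar ∷ [])    (_ , last)       = contradiction refl last
nested-dagger-span (bar ∷ d ∷ D) adm              = prepend-bar-span d D (nested-dagger-span (d ∷ D) (AdmBar-tail adm))

bzData : ℕ → ℕ × Poly
bzData k = (k , monomial (k ∸ 1))

nested-bz≗zeta : ∀ ks y → nested (map bzEntry ks) y ≡ nested (map zetaEntry (map bzData ks)) y
nested-bz≗zeta []       y = refl
nested-bz≗zeta (k ∷ ks) y =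
  extend-cong true (linear-cong (*S-linearˡ (geomPow k)) (λ m → sym (polyS-monomial (k ∸ 1) m)))
                   (nested-bz≗zeta ks) y

monomial-InXQ : ∀ {k} → 1 ≤ℕ k → k ≢ 1 → InXQ (monomial (k ∸ 1))
monomial-InXQ {suc zero}    _ k≢1 = contradiction refl k≢1
monomial-InXQ {suc (suc k)} _ _   = refl

bzData-last : ∀ ks → PosIdx ks → AdmLast ks → LastInXQ (map bzData ks)
bzData-last []           _           _    = tt
bzData-last (k ∷ [])     (1≤k ∷ [])  k≢1  = monomial-InXQ 1≤k k≢1
bzData-last (_ ∷ k ∷ ks) (_ ∷ pos)   last = bzData-last (k ∷ ks) pos last

bzData-valid : ∀ ks → Adm ks → ValidD 1 (map bzData ks)
bzData-valid ks (pos , last) =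
  map⁺ (All.map (λ {k} 1≤k → 1≤k , ℕP.≤-reflexive (length-monomial (k ∸ 1))) pos) , bzData-last ks pos last

bzData-allInXQ : ∀ ks → PosIdx ks → NoOne ks → All (InXQ ∘ proj₂) (map bzData ks)
bzData-allInXQ ks pos noOne = map⁺ (All.zipWith (λ (1≤k , k≢1) → monomial-InXQ 1≤k k≢1) (pos , noOne))

lin≡lincomb : {I : Set} (g : I → PS) (L : Combination I) (N : ℕ) → lin g L N ≡ lincomb L (λ i → g i N)
lin≡lincomb g []            N = refl
lin≡lincomb g ((c , i) ∷ L) N = cong (c * g i N +_) (lin≡lincomb g L N)

module _ {I J : Set} {P : I → Set} {P′ : J → Set} {g : I → PS} {h : J → PS} where

  InSpan-⊆ : (∀ i → P i → Spanned P′ h (g i)) → ∀ {f} → InSpan P g f → InSpan P′ h f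
  InSpan-⊆ g∈ (L , PL , f≗L) =
    let (M , PM , f≗M) = span-bind (L , PL , λ N → trans (f≗L N) (lin≡lincomb g L N)) g∈
    in M , PM , λ N → trans (f≗M N) (sym (lin≡lincomb h M N))

sameSpan : {I J : Set} {P : I → Set} {P′ : J → Set} {g : I → PS} {h : J → PS} →
  (∀ i → P i → Spanned P′ h (g i)) → (∀ j → P′ j → Spanned P g (h j)) →
  SameSet (InSpan P g) (InSpan P′ h)
sameSpan g∈ h∈ f = InSpan-⊆ g∈ , InSpan-⊆ h∈

module DaggerExpansion = Expansion daggerFactor 0 AdmBar NoBar ([] , tt) [] (λ k Q _ → prepend-dagger k Q)
module BZExpansion     = Expansion bzEntry 1 Adm NoOne ([] , tt) [] prepend-bz

zetaQ∈span-zetaDagger : ∀ ks → ValidD 0 ks → Spanned AdmBar zetaDagger (zetaQ ks)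
zetaQ∈span-zetaDagger ks valid = span-mono proj₁ (DaggerExpansion.zetaQ-span ks valid)

zetaQ°∈span-zetaDagger° : ∀ ks → ValidD° 0 ks → Spanned (λ D → AdmBar D × NoBar D) zetaDagger (zetaQ ks)
zetaQ°∈span-zetaDagger° ks (valid , allInXQ) =
  span-mono (λ (adm , noBar) → adm , noBar allInXQ) (DaggerExpansion.zetaQ-span ks valid)

zetaDagger∈span-zetaQ : ∀ D → AdmBar D → Spanned (ValidD 0) zetaQ (zetaDagger D)
zetaDagger∈span-zetaQ D adm = span-mono proj₁ (span-map (linear-at (0 ,_)) (nested-dagger-span D adm))

zetaDagger°∈span-zetaQ° : ∀ D → AdmBar D × NoBar D → Spanned (ValidD° 0) zetaQ (zetaDagger D)
zetaDagger°∈span-zetaQ° D (adm , noBar) =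
  span-mono (λ (valid , allInXQ , _) → valid , allInXQ noBar) (span-map (linear-at (0 ,_)) (nested-dagger-span D adm))

zetaQ∈span-zetaBZ : ∀ ks → ValidD 1 ks → Spanned Adm zetaBZ (zetaQ ks)
zetaQ∈span-zetaBZ ks valid = span-mono proj₁ (BZExpansion.zetaQ-span ks valid)

zetaQ°∈span-zetaBZ° : ∀ ks → ValidD° 1 ks → Spanned (λ D → Adm D × NoOne D) zetaBZ (zetaQ ks)
zetaQ°∈span-zetaBZ° ks (valid , allInXQ) =
  span-mono (λ (adm , noOne) → adm , noOne allInXQ) (BZExpansion.zetaQ-span ks valid)

zetaBZ∈span-zetaQ : ∀ ks → Adm ks → Spanned (ValidD 1) zetaQ (zetaBZ ks)
zetaBZ∈span-zetaQ ks adm = span-resp (λ N → sym (nested-bz≗zeta ks (0 , N))) (span-gen (bzData-valid ks adm))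

zetaBZ°∈span-zetaQ° : ∀ ks → Adm ks × NoOne ks → Spanned (ValidD° 1) zetaQ (zetaBZ ks)
zetaBZ°∈span-zetaQ° ks (adm , noOne) =
  span-resp (λ N → sym (nested-bz≗zeta ks (0 , N)))
    (span-gen (bzData-valid ks adm , bzData-allInXQ ks (proj₁ adm) noOne))

lemma2p4 :
    SameSet (Zqd 0) (InSpan AdmBar zetaDagger)
    × SameSet (Zqd° 0) (InSpan (λ ks → AdmBar ks × NoBar ks) zetaDagger)
    × SameSet (Zqd 1) (InSpan Adm zetaBZ)
    × SameSet (Zqd° 1) (InSpan (λ ks → Adm ks × NoOne ks) zetaBZ)
lemma2p4 =
    sameSpan zetaQ∈span-zetaDagger zetaDagger∈span-zetaQ
  , sameSpan zetaQ°∈span-zetaDagger° zetaDagger°∈span-zetaQ°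
  , sameSpan zetaQ∈span-zetaBZ zetaBZ∈span-zetaQ
  , sameSpan zetaQ°∈span-zetaBZ° zetaBZ°∈span-zetaQ°
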